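{- Let $A_1=(\mathcal{S}_1,\mathcal{E},\mathcal{I}_1,\mathcal{F}_1,\to_1)$ and $A_2=(\mathcal{S}_2,\mathcal{E},\mathcal{I}_2,\mathcal{F}_2,\to_2)$ be Büchi automata over the same set of events. For $X\subseteq\mathcal{S}_1\times\mathcal{S}_2$ define $$\texttt{fsim}^\texttt{R}_\texttt{delay}(X)\triangleq\mu Y.\ \{(s_1,s_2)\mid s_2\in\mathcal{F}_2\wedge\forall e.\forall s_1\xrightarrow{e}_1 s_1'.\exists s_2\xrightarrow{e}_2 s_2'.\ (s_1',s_2')\in X\}\ \cup\ \{(s_1,s_2)\mid \forall e.\forall s_1\xrightarrow{e}_1 s_1'.\exists s_2\xrightarrow{e}_2 s_2'.\ (s_1',s_2')\in Y\},$$ and $$\texttt{fsim}^\texttt{L}_\texttt{delay}\triangleq\nu X.\ \texttt{fsim}^\texttt{R}_\texttt{delay}(X)\ \cup\ \{(s_1,s_2)\mid s_1\notin\mathcal{F}_1\wedge\forall e.\forall s_1\xrightarrow{e}_1 s_1'.\exists s_2\xrightarrow{e}_2 s_2'.\ (s_1',s_2')\in X\}.$$ Then for all $(s_1,s_2)\in\texttt{fsim}^\texttt{L}_\texttt{delay}$, $\mathcal{L}_{A_1}(s_1)\subseteq\mathcal{L}_{A_2}(s_2)$.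
   Context: A Büchi automaton $(\mathcal{S},\mathcal{E},\mathcal{I},\mathcal{F},\to)$ consists of a set of states $\mathcal{S}$ (not necessarily finite), a set of events $\mathcal{E}$, initial states $\mathcal{I}\subseteq\mathcal{S}$, accepting states $\mathcal{F}\subseteq\mathcal{S}$, and a labeled transition relation $\to\subseteq\mathcal{S}\times\mathcal{E}\times\mathcal{S}$ (written $s\xrightarrow{e}s'$). $\nu$ and $\mu$ denote greatest and least fixed points of monotone operators on powerset lattices. The language of automaton $A$ is $\mathcal{L}_A\triangleq\nu L.\ \mu X.\ \{(s,e\cdot\tau)\mid \exists s\xrightarrow{e}s'.\ (s',\tau)\in X\}\cup\{(s,e\cdot\tau)\mid s\in\mathcal{F}\wedge \exists s\xrightarrow{e}s'.\ (s',\tau)\in L\}\subseteq\mathcal{S}\times\mathcal{E}^\omega$, and $\mathcal{L}_A(s)\triangleq\{\tau\mid (s,\tau)\in\mathcal{L}_A\}$. -}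

module Defs where

open import Data.Nat using (ℕ; zero; suc)
open import Data.Product using (Σ; _×_; _,_)
open import Data.Sum using (_⊎_)
open import Relation.Nullary using (¬_)

Trace : Set → Set
Trace E = ℕ → E

head : {E : Set} → Trace E → E
head τ = τ 0

tail : {E : Set} → Trace E → Trace E
tail τ n = τ (suc n)

record Buchi (E : Set) : Set₁ where
  field
    State : Set
    Init  : State → Set
    Acc   : State → Set
    Step  : State → E → State → Set

module _ {E : Set} (A : Buchi E) where
  open Buchi A

  data LangR (L : State → Trace E → Set) : State → Trace E → Set where
    step : ∀ {s τ} s' → Step s (head τ) s' → LangR L s' (tail τ) → LangR L s τ
    acc  : ∀ {s τ} s' → Acc s → Step s (head τ) s' → L s' (tail τ) → LangR L s τ

  -- Outer greatest fixed point  L_A = νL. μX. ... , taken as the Knaster–Tarski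
  -- greatest fixed point: the union of all post-fixed points L ⊆ LangR L.
  -- (s,τ) ∈ L_A, i.e. τ ∈ L_A(s):
  Language : State → Trace E → Set₁
  Language s τ = Σ (State → Trace E → Set) λ L →
                   (∀ s' τ' → L s' τ' → LangR L s' τ') × L s τ

module _ {E : Set} (A₁ A₂ : Buchi E) where
  private
    module A₁ = Buchi A₁
    module A₂ = Buchi A₂
  open A₁ using () renaming (State to S₁; Acc to F₁; Step to Step₁)
  open A₂ using () renaming (State to S₂; Acc to F₂; Step to Step₂)

  SimStep : (S₁ → S₂ → Set) → S₁ → S₂ → Set
  SimStep X s₁ s₂ = ∀ e s₁' → Step₁ s₁ e s₁' → Σ S₂ λ s₂' → Step₂ s₂ e s₂' × X s₁' s₂'

  data FsimR (X : S₁ → S₂ → Set) : S₁ → S₂ → Set where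
    base : ∀ {s₁ s₂} → F₂ s₂ →
           (∀ e s₁' → Step₁ s₁ e s₁' → Σ S₂ λ s₂' → Step₂ s₂ e s₂' × X s₁' s₂') →
           FsimR X s₁ s₂
    ind  : ∀ {s₁ s₂} →
           (∀ e s₁' → Step₁ s₁ e s₁' → Σ S₂ λ s₂' → Step₂ s₂ e s₂' × FsimR X s₁' s₂') →
           FsimR X s₁ s₂

  FsimLOp : (S₁ → S₂ → Set) → S₁ → S₂ → Set
  FsimLOp X s₁ s₂ = FsimR X s₁ s₂ ⊎ (¬ F₁ s₁ × SimStep X s₁ s₂)

  -- fsim^L_delay = νX. FsimLOp X, as the Knaster–Tarski greatest fixed point
  -- (union of all post-fixed points X ⊆ FsimLOp X).
  FsimL : S₁ → S₂ → Set₁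
  FsimL s₁ s₂ = Σ (S₁ → S₂ → Set) λ X →
                  (∀ s₁' s₂' → X s₁' s₂' → FsimLOp X s₁' s₂') × X s₁ s₂

{-# OPTIONS --safe #-}
module Submission where

open import Data.Empty using (⊥-elim)
open import Data.Product using (Σ; _×_; _,_)
open import Data.Sum using (inj₁; inj₂)

open import Defs

-- Given post-fixed points X (for the simulation) and L₁ (for the language of A₁), the
-- relation "s₂ is X-related to some s₁ that has an L₁-run on τ" is a post-fixed point of
-- A₂'s language operator. We follow the inductive LangR-run of A₁: while X-related states
-- are in the left component, s₁ is non-accepting, so the run takes a plain step; since the
-- run is well-founded it must reach the FsimR component, whose least fixed point forces A₂
-- through an accepting state after finitely many steps.

module _ {E : Set} (A : Buchi E) where
  open Buchi A

  LangR-unfold : {L : State → Trace E → Set} → (∀ s τ → L s τ → LangR A L s τ) →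
                 ∀ {s τ} → LangR A L s τ →
                 Σ State λ s' → Step s (head τ) s' × LangR A L s' (tail τ)
  LangR-unfold L-post (step s' s→s' r)  = s' , s→s' , r
  LangR-unfold L-post (acc s' _ s→s' l) = s' , s→s' , L-post s' _ l

module _ {E : Set} (A₁ A₂ : Buchi E) where
  open Buchi A₁ using () renaming (State to S₁; Acc to F₁)
  open Buchi A₂ using () renaming (State to S₂)

  Simulated : (S₁ → S₂ → Set) → (S₁ → Trace E → Set) → S₂ → Trace E → Set
  Simulated X L₁ s₂ τ = Σ S₁ λ s₁ → X s₁ s₂ × LangR A₁ L₁ s₁ τ

  module _ {X : S₁ → S₂ → Set} {L₁ : S₁ → Trace E → Set}
           (L₁-post : ∀ s τ → L₁ s τ → LangR A₁ L₁ s τ) where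

    FsimR⇒LangR : ∀ {s₁ s₂ τ} → FsimR A₁ A₂ X s₁ s₂ → LangR A₁ L₁ s₁ τ →
                  LangR A₂ (Simulated X L₁) s₂ τ
    FsimR⇒LangR {τ = τ} (base s₂∈F₂ sim) r with LangR-unfold A₁ L₁-post r
    ... | s₁' , s₁→s₁' , r' with sim (head τ) s₁' s₁→s₁'
    ... | s₂' , s₂→s₂' , x' = acc s₂' s₂∈F₂ s₂→s₂' (s₁' , x' , r')
    FsimR⇒LangR {τ = τ} (ind sim) r with LangR-unfold A₁ L₁-post r
    ... | s₁' , s₁→s₁' , r' with sim (head τ) s₁' s₁→s₁'
    ... | s₂' , s₂→s₂' , fsim' = step s₂' s₂→s₂' (FsimR⇒LangR fsim' r')

    module _ (X-post : ∀ s₁ s₂ → X s₁ s₂ → FsimLOp A₁ A₂ X s₁ s₂) where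

      X⇒LangR : ∀ {s₁ s₂ τ} → X s₁ s₂ → LangR A₁ L₁ s₁ τ → LangR A₂ (Simulated X L₁) s₂ τ
      X⇒LangR {s₁} {s₂} x r with X-post s₁ s₂ x
      ... | inj₁ fsim = FsimR⇒LangR fsim r
      X⇒LangR x (acc _ s₁∈F₁ _ _)    | inj₂ (s₁∉F₁ , _) = ⊥-elim (s₁∉F₁ s₁∈F₁)
      X⇒LangR x (step s₁' s₁→s₁' r') | inj₂ (_ , sim) with sim _ s₁' s₁→s₁'
      ... | s₂' , s₂→s₂' , x' = step s₂' s₂→s₂' (X⇒LangR x' r')

      Simulated-post : ∀ s₂ τ → Simulated X L₁ s₂ τ → LangR A₂ (Simulated X L₁) s₂ τ
      Simulated-post _ _ (_ , x , r) = X⇒LangR x r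

theorem4p4 : {E : Set} (A₁ A₂ : Buchi E) (s₁ : Buchi.State A₁) (s₂ : Buchi.State A₂) →
    FsimL A₁ A₂ s₁ s₂ → (τ : Trace E) → Language A₁ s₁ τ → Language A₂ s₂ τ
theorem4p4 A₁ A₂ s₁ s₂ (X , X-post , x) τ (L₁ , L₁-post , l) =
  Simulated A₁ A₂ X L₁ ,
  Simulated-post A₁ A₂ L₁-post X-post ,
  (s₁ , x , L₁-post s₁ τ l)
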